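{- Let $I=(G,U,D,k)$ be a \textsc{Disjoint-FVS} instance. Consider the following reduction rules, where at any time the lowest-numbered applicable rule is applied: Rule 1: remove all vertices of degree at most $1$ from $G$. Rule 2: if a vertex $v \in D$ has at least two neighbours in the same connected component of $G[U]$, delete $v$ and decrease $k$ by one. Rule 3: if there exists a vertex $v \in D$ of degree $2$ in $G$, move it to $U$ if it has a neighbour in $U$, and otherwise (both neighbours in $D$) contract one of its incident edges. Then an application of any of Rules 1--3 does not increase $\mu(I)$.
   Context: \textsc{Disjoint-FVS}: an instance $I=(G,U,D,k)$ consists of a simple undirected graph $G$, a partition $V(G)=U\cup D$ such that both induced subgraphs $G[U]$ and $G[D]$ are forests, and an integer $k$; the question is whether there is $X\subseteq D$ with $|X|\le k$ such that $G\setminus X$ is a forest. A vertex $v\in D$ is a tent if it has no neighbours in $D$ and has degree exactly $3$ in $G$. Define $k(I)=k$, $\ell(I)$ = the number of connected components of $G[U]$, $t(I)$ = the number of tents, and $\mu(I)=k(I)+\ell(I)-t(I)$. Contracting an edge $uv$ replaces $u,v$ by a single new vertex adjacent to every vertex of $(N_G(u)\cup N_G(v))\setminus\{u,v\}$ (multiplicities of edges are summed and loops are kept, so multiple edges/loops are not suppressed). -}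

module Defs where

open import Data.Nat using (ℕ; zero; suc; _+_; _≤_; _≤ᵇ_; _≡ᵇ_)
open import Data.Integer as ℤ using (ℤ; +_; _-_)
open import Data.Fin using (Fin; zero; suc; _≟_)
open import Data.Bool using (Bool; true; false; _∧_; _∨_; not; if_then_else_; T)
open import Data.List using (List; []; _∷_; length)
open import Data.List.Relation.Unary.All using (All)
open import Data.List.Relation.Unary.Unique.Propositional using (Unique)
open import Data.Product using (Σ; ∃; _×_; _,_)
open import Data.Unit using (⊤)
open import Data.Empty using (⊥)
open import Function using (_∘_; _⇔_)
open import Relation.Nullary using (¬_)
open import Relation.Nullary.Decidable using (⌊_⌋)
open import Relation.Binary.PropositionalEquality using (_≡_)

count : ∀ {n} → (Fin n → Bool) → ℕ
count {zero}  p = 0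
count {suc n} p = (if p zero then 1 else 0) + count (p ∘ suc)

-- The actual vertex set of G is
-- {v | pres v ≡ true}; 'adj' is the (boolean) adjacency relation, only
-- meaningful between present vertices; 'inU v' says v ∈ U (otherwise v ∈ D).
record Inst (n : ℕ) : Set where
  field
    pres : Fin n → Bool
    adj  : Fin n → Fin n → Bool
    inU  : Fin n → Bool
    k    : ℤ
open Inst public

_==_ : ∀ {n} → Fin n → Fin n → Bool
x == y = ⌊ x ≟ y ⌋

module _ {n : ℕ} (I : Inst n) where

  edgeB : Fin n → Fin n → Bool
  edgeB x y = pres I x ∧ pres I y ∧ adj I x y

  Edge : Fin n → Fin n → Set
  Edge x y = T (edgeB x y)

  InU : Fin n → Set
  InU v = T (pres I v ∧ inU I v)

  InD : Fin n → Set
  InD v = T (pres I v ∧ not (inU I v))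

  deg : Fin n → ℕ
  deg v = count (edgeB v)

  isTent : Fin n → Bool
  isTent v = pres I v ∧ not (inU I v) ∧ (deg v ≡ᵇ 3)
             ∧ (count (λ w → edgeB v w ∧ not (inU I w)) ≡ᵇ 0)

  tents : ℕ
  tents = count isTent

  Consec : (Fin n → Fin n → Set) → List (Fin n) → Set
  Consec R []           = ⊤
  Consec R (x ∷ [])     = ⊤
  Consec R (x ∷ y ∷ xs) = R x y × Consec R (y ∷ xs)

  lastOf : Fin n → List (Fin n) → Fin n
  lastOf x []       = x
  lastOf x (y ∷ ys) = lastOf y ys

  CycleIn : (Fin n → Set) → Set
  CycleIn S = Σ (Fin n) λ x → Σ (List (Fin n)) λ ys →
      (2 ≤ length ys) × Unique (x ∷ ys) × All S (x ∷ ys)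
    × Consec Edge (x ∷ ys) × Edge (lastOf x ys) x

  ForestIn : (Fin n → Set) → Set
  ForestIn S = ¬ CycleIn S

  data Reach (S : Fin n → Set) : Fin n → Fin n → Set where
    here : ∀ {x} → S x → Reach S x x
    step : ∀ {x y z} → Reach S x y → Edge y z → S z → Reach S x z

  -- G[S] has exactly c connected components: a surjective labelling of
  -- the vertices of S by Fin c whose fibres are exactly the components.
  NumComponents : (Fin n → Set) → ℕ → Set
  NumComponents S c = Σ (Fin n → Fin c) λ f →
      (∀ x y → S x → S y → (f x ≡ f y ⇔ Reach S x y))
    × (∀ i → ∃ λ x → S x × f x ≡ i)

  Ell : ℕ → Set
  Ell c = NumComponents InU c

  mu : ℕ → ℤ
  mu c = (k I ℤ.+ + c) - + tents

  Valid : Set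
  Valid = (∀ x y → adj I x y ≡ adj I y x)
        × (∀ x → adj I x x ≡ false)
        × ForestIn InU × ForestIn InD

  Rule1App : Set
  Rule1App = ∃ λ v → T (pres I v) × deg v ≤ 1

  Rule2At : Fin n → Set
  Rule2At v = InD v × ∃ λ a → ∃ λ b → ¬ a ≡ b × Edge v a × Edge v b
              × InU a × InU b × Reach InU a b

  Rule2App : Set
  Rule2App = ∃ Rule2At

rule1 : ∀ {n} → Inst n → Inst n
rule1 I = record I { pres = λ v → pres I v ∧ not (deg I v ≤ᵇ 1) }

deleteV : ∀ {n} → Inst n → Fin n → Inst n
deleteV I v = record I { pres = λ w → pres I w ∧ not (w == v)
                       ; k = k I - + 1 }

moveToU : ∀ {n} → Inst n → Fin n → Inst n
moveToU I v = record I { inU = λ w → inU I w ∨ (w == v) }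

-- contract the edge va; the new vertex is named a (it lies in D like a)
contract : ∀ {n} → Inst n → Fin n → Fin n → Inst n
contract I v a = record I
  { pres = λ w → pres I w ∧ not (w == v)
  ; adj  = λ x y → adj I x y
                   ∨ ((x == a) ∧ adj I v y ∧ not (y == a))
                   ∨ ((y == a) ∧ adj I v x ∧ not (x == a)) }

-- one application of Rules 1–3 under "lowest-numbered applicable rule first"
data Step {n : ℕ} (I : Inst n) : Inst n → Set where
  r1  : Rule1App I → Step I (rule1 I)
  r2  : ∀ v → ¬ Rule1App I → Rule2At I v → Step I (deleteV I v)
  r3U : ∀ v u → ¬ Rule1App I → ¬ Rule2App I → InD I v → deg I v ≡ 2
      → Edge I v u → InU I u → Step I (moveToU I v)
  r3D : ∀ v a → ¬ Rule1App I → ¬ Rule2App I → InD I v → deg I v ≡ 2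
      → (∀ w → Edge I v w → InD I w) → Edge I v a → Step I (contract I v a)

-- μ = k + ℓ − t, so it suffices to compare ℓ′ + t with ℓ + t′ (allowing one more on the right for
-- Rule 2, which lowers k). A tent has no neighbour in D, so deleting a vertex v ∈ D, contracting an edge at v,
-- or moving v to U keeps every tent other than v itself, and v is no tent under Rule 3, having degree 2;
-- none of these operations increases the number of components of G[U]. Rule 1 destroys a tent x only by
-- removing a U-neighbour u of degree ≤ 1: then {u} is a component of G[U] on its own, u determines x, and
-- removing vertices of degree ≤ 1 disconnects no surviving component, so ℓ drops by at least the number
-- of destroyed tents.

module Submission where

open import Defs
open import Data.Bool using (Bool; true; false; _∧_; _∨_; not; T; if_then_else_)
open import Data.Bool.Properties using (T-∧; T-∨)
open import Data.Empty using (⊥-elim)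
open import Data.Fin using (Fin; zero; suc; _≟_; splitAt; join)
import Data.Fin.Properties as Finₚ
open import Data.Integer using (ℤ; +_; _+_; _-_; -_; _≤_; +≤+)
import Data.Integer.Properties as ℤₚ
open import Data.Integer.Tactic.RingSolver using (solve-∀)
import Data.Nat as ℕ
open ℕ using (ℕ; zero; suc; z≤n; s≤s)
import Data.Nat.Properties as ℕₚ
open import Algebra.Properties.CommutativeSemigroup ℕₚ.+-commutativeSemigroup using (interchange)
open import Data.Product using (∃; _×_; _,_; proj₁; proj₂)
open import Data.Sum using (_⊎_; inj₁; inj₂; [_,_])
open import Function using (_∘_; id; _⇔_; mk⇔; Equivalence; Injective)
open import Relation.Nullary using (¬_; yes; no)
open import Relation.Nullary.Decidable
  using (T?; ¬?; _×-dec_; toWitness; fromWitness; fromWitnessFalse; decidable-stable)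
open import Relation.Binary.PropositionalEquality
  using (_≡_; _≢_; refl; sym; trans; cong; subst; subst₂; module ≡-Reasoning)

variable
  n : ℕ
  a b : Bool
  c c′ : ℕ
  x y z v w : Fin n
  I J : Inst n
  S S′ : Fin n → Set

∧-fst : ∀ a {b} → T (a ∧ b) → T a
∧-fst a = proj₁ ∘ Equivalence.to (T-∧ {a})

∧-snd : ∀ a {b} → T (a ∧ b) → T b
∧-snd a = proj₂ ∘ Equivalence.to (T-∧ {a})

∧-intro : T a → T b → T (a ∧ b)
∧-intro p q = Equivalence.from T-∧ (p , q)

∨-elim : ∀ a {b} → T (a ∨ b) → T a ⊎ T b
∨-elim a = Equivalence.to (T-∨ {a})

∨-introˡ : T a → T (a ∨ b)
∨-introˡ = Equivalence.from T-∨ ∘ inj₁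

∨-introʳ : ∀ a {b} → T b → T (a ∨ b)
∨-introʳ a = Equivalence.from (T-∨ {a}) ∘ inj₂

not-intro : ¬ T a → T (not a)
not-intro {false} _  = _
not-intro {true}  ¬t = ¬t _

not-elim : T (not a) → ¬ T a
not-elim {false} _ ()

private
  indicator-mono : (T a → T b) → (if a then 1 else 0) ℕ.≤ (if b then 1 else 0)
  indicator-mono {false}         _   = z≤n
  indicator-mono {true} {true}   _   = ℕₚ.≤-refl
  indicator-mono {true} {false} a⇒b = ⊥-elim (a⇒b _)

  indicator-∪ : ∀ {a b c} → (T a → T b ⊎ T c) →
                (if a then 1 else 0) ℕ.≤ (if b then 1 else 0) ℕ.+ (if c then 1 else 0)
  indicator-∪ {false}                  _ = z≤n
  indicator-∪ {true} {true}            _ = s≤s z≤n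
  indicator-∪ {true} {false} {true}    _ = s≤s z≤n
  indicator-∪ {true} {false} {false} a⇒b∨c with a⇒b∨c _
  ... | inj₁ ()
  ... | inj₂ ()

count-mono : {p q : Fin n → Bool} → (∀ x → T (p x) → T (q x)) → count p ℕ.≤ count q
count-mono {zero}  _   = z≤n
count-mono {suc n} p⊆q = ℕₚ.+-mono-≤ (indicator-mono (p⊆q zero)) (count-mono (p⊆q ∘ suc))

count-cong : {p q : Fin n → Bool} → (∀ x → T (p x) ⇔ T (q x)) → count p ≡ count q
count-cong p⇔q = ℕₚ.≤-antisym (count-mono (Equivalence.to ∘ p⇔q))
                              (count-mono (Equivalence.from ∘ p⇔q))

count-∪ : {p q r : Fin n → Bool} → (∀ x → T (p x) → T (q x) ⊎ T (r x)) →
          count p ℕ.≤ count q ℕ.+ count r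
count-∪ {zero}          _     = z≤n
count-∪ {suc n} {q = q} {r} p⊆q∪r = ℕₚ.≤-trans
  (ℕₚ.+-mono-≤ (indicator-∪ (p⊆q∪r zero)) (count-∪ (p⊆q∪r ∘ suc)))
  (ℕₚ.≤-reflexive (interchange (if q zero then 1 else 0) (if r zero then 1 else 0)
                               (count (q ∘ suc)) (count (r ∘ suc))))

count-≥1 : {p : Fin n → Bool} → T (p x) → 1 ℕ.≤ count p
count-≥1 {x = zero}  {p} px with p zero
... | true = s≤s z≤n
count-≥1 {x = suc x} {p} px = ℕₚ.≤-trans (count-≥1 {p = p ∘ suc} px) (ℕₚ.m≤n+m _ _)

count-≥2 : {p : Fin n → Bool} → x ≢ y → T (p x) → T (p y) → 2 ℕ.≤ count p
count-≥2 {x = zero}  {zero}  x≢y _ _ = ⊥-elim (x≢y refl)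
count-≥2 {x = zero}  {suc y} {p} _ px py with p zero
... | true = s≤s (count-≥1 {p = p ∘ suc} py)
count-≥2 {x = suc x} {zero}  {p} _ px py with p zero
... | true = s≤s (count-≥1 {p = p ∘ suc} px)
count-≥2 {x = suc x} {suc y} {p} x≢y px py =
  ℕₚ.≤-trans (count-≥2 {p = p ∘ suc} (x≢y ∘ cong suc) px py) (ℕₚ.m≤n+m _ _)

count≡0⇒¬p : {p : Fin n → Bool} → count p ≡ 0 → ¬ T (p x)
count≡0⇒¬p {p = p} c≡0 px with subst (1 ℕ.≤_) c≡0 (count-≥1 {p = p} px)
... | ()

none⇒count≡0 : {p : Fin n → Bool} → (∀ x → ¬ T (p x)) → count p ≡ 0
none⇒count≡0 {zero}         _    = refl
none⇒count≡0 {suc n} {p} none with p zero in p0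
... | true  = ⊥-elim (none zero (subst T (sym p0) _))
... | false = none⇒count≡0 (none ∘ suc)

enumerate : (p : Fin n → Bool) → Fin (count p) → Fin n
enumerate {suc n} p i with p zero
enumerate {suc n} p zero    | true  = zero
enumerate {suc n} p (suc i) | true  = suc (enumerate (p ∘ suc) i)
enumerate {suc n} p i       | false = suc (enumerate (p ∘ suc) i)

enumerate-sound : (p : Fin n → Bool) (i : Fin (count p)) → T (p (enumerate p i))
enumerate-sound {suc n} p i with p zero in p0
enumerate-sound {suc n} p zero    | true  = subst T (sym p0) _
enumerate-sound {suc n} p (suc i) | true  = enumerate-sound (p ∘ suc) i
enumerate-sound {suc n} p i       | false = enumerate-sound (p ∘ suc) i

enumerate-injective : (p : Fin n → Bool) → Injective _≡_ _≡_ (enumerate p)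
enumerate-injective {suc n} p {i} {j} e with p zero
enumerate-injective {suc n} p {zero}  {zero}  e  | true = refl
enumerate-injective {suc n} p {suc i} {suc j} e  | true =
  cong suc (enumerate-injective (p ∘ suc) (Finₚ.suc-injective e))
enumerate-injective {suc n} p {i}     {j}     e  | false =
  enumerate-injective (p ∘ suc) (Finₚ.suc-injective e)

+-count-≤ : ∀ {m c} {p : Fin n → Bool} (g : Fin m → Fin c) (φ : ∀ x → T (p x) → Fin c) →
            Injective _≡_ _≡_ g → (∀ {x y} px py → φ x px ≡ φ y py → x ≡ y) →
            (∀ i x px → g i ≢ φ x px) → m ℕ.+ count p ℕ.≤ c
+-count-≤ {m = m} {c} {p} g φ g-inj φ-inj disjoint =
  Finₚ.injective⇒≤ {f = h ∘ splitAt m} (splitAt-injective ∘ h-injective _ _)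
  where
  h : Fin m ⊎ Fin (count p) → Fin c
  h = [ g , (λ j → φ (enumerate p j) (enumerate-sound p j)) ]

  h-injective : ∀ s t → h s ≡ h t → s ≡ t
  h-injective (inj₁ i) (inj₁ j) e = cong inj₁ (g-inj e)
  h-injective (inj₁ i) (inj₂ j) e = ⊥-elim (disjoint i _ _ e)
  h-injective (inj₂ i) (inj₁ j) e = ⊥-elim (disjoint j _ _ (sym e))
  h-injective (inj₂ i) (inj₂ j) e = cong inj₂ (enumerate-injective p (φ-inj _ _ e))

  splitAt-injective : ∀ {i j} → splitAt m i ≡ splitAt m j → i ≡ j
  splitAt-injective {i} {j} e = begin
    i                            ≡⟨ Finₚ.join-splitAt m (count p) i ⟨
    join m (count p) (splitAt m i) ≡⟨ cong (join m (count p)) e ⟩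
    join m (count p) (splitAt m j) ≡⟨ Finₚ.join-splitAt m (count p) j ⟩
    j                            ∎
    where open ≡-Reasoning

count-≤1 : {p : Fin n → Bool} → (∀ {x y} → T (p x) → T (p y) → x ≡ y) → count p ℕ.≤ 1
count-≤1 unique = +-count-≤ {m = 0} (λ ()) (λ _ _ → zero) (λ {}) (λ px py _ → unique px py) (λ ())

Edge-pres₁ : ∀ (I : Inst n) {x y} → Edge I x y → T (pres I x)
Edge-pres₁ I {x} = ∧-fst (pres I x)

Edge-pres₂ : ∀ (I : Inst n) {x y} → Edge I x y → T (pres I y)
Edge-pres₂ I {x} {y} = ∧-fst (pres I y) ∘ ∧-snd (pres I x)

Edge-adj : ∀ (I : Inst n) {x y} → Edge I x y → T (adj I x y)
Edge-adj I {x} {y} = ∧-snd (pres I y) ∘ ∧-snd (pres I x)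

mkEdge : ∀ (I : Inst n) {x y} → T (pres I x) → T (pres I y) → T (adj I x y) → Edge I x y
mkEdge I px py xy = ∧-intro px (∧-intro py xy)

SymmetricAdj : Inst n → Set
SymmetricAdj I = ∀ x y → adj I x y ≡ adj I y x

Edge-sym : ∀ (I : Inst n) {x y} → SymmetricAdj I → Edge I x y → Edge I y x
Edge-sym I {x} {y} symmetric e =
  mkEdge I (Edge-pres₂ I e) (Edge-pres₁ I e) (subst T (symmetric x y) (Edge-adj I e))

InU-pres : ∀ (I : Inst n) {x} → InU I x → T (pres I x)
InU-pres I {x} = ∧-fst (pres I x)

InU-inU : ∀ (I : Inst n) {x} → InU I x → T (inU I x)
InU-inU I {x} = ∧-snd (pres I x)

InD-pres : ∀ (I : Inst n) {x} → InD I x → T (pres I x)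
InD-pres I {x} = ∧-fst (pres I x)

InD-notU : ∀ (I : Inst n) {x} → InD I x → ¬ T (inU I x)
InD-notU I {x} = not-elim ∘ ∧-snd (pres I x)

InU≢InD : ∀ (I : Inst n) {x y} → InU I x → InD I y → x ≢ y
InU≢InD I x∈U y∈D refl = InD-notU I y∈D (InU-inU I x∈U)

deg≤1-unique : ∀ (I : Inst n) {u x y} → deg I u ℕ.≤ 1 → Edge I u x → Edge I u y → x ≡ y
deg≤1-unique I {u} {x} {y} d≤1 ex ey with x ≟ y
... | yes x≡y = x≡y
... | no  x≢y = ⊥-elim (ℕₚ.<-irrefl refl
                  (ℕₚ.≤-trans (count-≥2 {x = x} {y} {edgeB I u} x≢y ex ey) d≤1))

record Tent (I : Inst n) (x : Fin n) : Set where
  field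
    tent-∈D    : InD I x
    tent-deg   : deg I x ≡ 3
    tent-nbr∈U : ∀ {w} → Edge I x w → T (inU I w)
open Tent

isTent⇔Tent : T (isTent I x) ⇔ Tent I x
isTent⇔Tent {n} {I = I} {x} = mk⇔ to from
  where
  nbrInD : Fin n → Bool
  nbrInD w = edgeB I x w ∧ not (inU I w)

  to : T (isTent I x) → Tent I x
  to t = record
    { tent-∈D    = ∧-intro (∧-fst (pres I x) t) (∧-fst (not (inU I x)) rest)
    ; tent-deg   = ℕₚ.≡ᵇ⇒≡ _ 3 (∧-fst (deg I x ℕ.≡ᵇ 3) conds)
    ; tent-nbr∈U = λ {w} e → decidable-stable (T? (inU I w)) λ w∉U →
        count≡0⇒¬p {p = nbrInD} (ℕₚ.≡ᵇ⇒≡ _ 0 (∧-snd (deg I x ℕ.≡ᵇ 3) conds)) (∧-intro e (not-intro w∉U))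
    }
    where
    rest : T (not (inU I x) ∧ (deg I x ℕ.≡ᵇ 3) ∧ (count nbrInD ℕ.≡ᵇ 0))
    rest = ∧-snd (pres I x) t
    conds : T ((deg I x ℕ.≡ᵇ 3) ∧ (count nbrInD ℕ.≡ᵇ 0))
    conds = ∧-snd (not (inU I x)) rest

  from : Tent I x → T (isTent I x)
  from τ = ∧-intro (InD-pres I (tent-∈D τ)) (∧-intro (∧-snd (pres I x) (tent-∈D τ))
             (∧-intro (ℕₚ.≡⇒≡ᵇ _ 3 (tent-deg τ))
                      (ℕₚ.≡⇒≡ᵇ _ 0 (none⇒count≡0 {p = nbrInD} nbrInD-absent))))
    where
    nbrInD-absent : ∀ w → ¬ T (nbrInD w)
    nbrInD-absent w t = not-elim (∧-snd (edgeB I x w) t) (tent-nbr∈U τ (∧-fst (edgeB I x w) t))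

Tent-≢-deg2 : Tent I x → deg I v ≡ 2 → x ≢ v
Tent-≢-deg2 τ d≡2 refl with trans (sym (tent-deg τ)) d≡2
... | ()

Tent-¬Edge-D : Tent I x → InD I w → ¬ Edge I x w
Tent-¬Edge-D {I = I} τ w∈D e = InD-notU I w∈D (tent-nbr∈U τ e)

Tent-transfer : Tent I x → InD J x →
                (∀ {w} → Edge I x w → Edge J x w) → (∀ {w} → Edge J x w → Edge I x w) →
                (∀ {w} → T (inU I w) → T (inU J w)) → Tent J x
Tent-transfer {I = I} {x} {J} τ x∈D′ fwd bwd U⊆U′ = record
  { tent-∈D    = x∈D′
  ; tent-deg   = trans (count-cong {p = edgeB J x} {q = edgeB I x} λ _ → mk⇔ bwd fwd) (tent-deg τ)
  ; tent-nbr∈U = U⊆U′ ∘ tent-nbr∈U τ ∘ bwd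
  }

tents-mono : (∀ {x} → Tent I x → Tent J x) → tents I ℕ.≤ tents J
tents-mono {I = I} {J} keep =
  count-mono {p = isTent I} {q = isTent J} λ _ →
    Equivalence.from isTent⇔Tent ∘ keep ∘ Equivalence.to isTent⇔Tent

tents-≤-+-count : {p : Fin n → Bool} → (∀ {x} → Tent I x → ¬ Tent J x → T (p x)) →
                  tents I ℕ.≤ tents J ℕ.+ count p
tents-≤-+-count {I = I} {J} {p} lost = count-∪ split
  where
  split : ∀ x → T (isTent I x) → T (isTent J x) ⊎ T (p x)
  split x t with T? (isTent J x)
  ... | yes t′ = inj₁ t′
  ... | no ¬t′ = inj₂ (lost (Equivalence.to isTent⇔Tent t) (¬t′ ∘ Equivalence.from isTent⇔Tent))

Reach-target : Reach I S x y → S y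
Reach-target (here y∈S)     = y∈S
Reach-target (step _ _ y∈S) = y∈S

Reach-trans : Reach I S x y → Reach I S y z → Reach I S x z
Reach-trans r (here _)         = r
Reach-trans r (step r′ e z∈S) = step (Reach-trans r r′) e z∈S

Reach-map : (∀ {z} → S z → S′ z) → (∀ {y z} → S y → S z → Edge I y z → Edge J y z) →
            Reach I S x y → Reach J S′ x y
Reach-map S⊆S′ E⊆E′ (here x∈S)     = here (S⊆S′ x∈S)
Reach-map S⊆S′ E⊆E′ (step r e z∈S) =
  step (Reach-map S⊆S′ E⊆E′ r) (E⊆E′ (Reach-target r) z∈S e) (S⊆S′ z∈S)

Reach-isolated : (∀ {z} → Edge I x z → ¬ S z) → Reach I S x y → x ≡ y
Reach-isolated isolated (here _) = refl
Reach-isolated isolated (step r e z∈S) with Reach-isolated isolated r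
... | refl = ⊥-elim (isolated e z∈S)

module _ {n} {I : Inst n} {S : Fin n → Set} {c} (C : NumComponents I S c) where

  label : Fin n → Fin c
  label = proj₁ C

  label-≡⇒Reach : S x → S y → label x ≡ label y → Reach I S x y
  label-≡⇒Reach x∈S y∈S = Equivalence.to (proj₁ (proj₂ C) _ _ x∈S y∈S)

  Reach⇒label-≡ : S x → S y → Reach I S x y → label x ≡ label y
  Reach⇒label-≡ x∈S y∈S = Equivalence.from (proj₁ (proj₂ C) _ _ x∈S y∈S)

  representative : Fin c → Fin n
  representative i = proj₁ (proj₂ (proj₂ C) i)

  representative-∈ : ∀ i → S (representative i)
  representative-∈ i = proj₁ (proj₂ (proj₂ (proj₂ C) i))

  label-representative : ∀ i → label (representative i) ≡ i
  label-representative i = proj₂ (proj₂ (proj₂ (proj₂ C) i))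

componentMap : ∀ {n} {I J : Inst n} {S S′ : Fin n → Set} {c c′} →
               NumComponents I S c → NumComponents J S′ c′ → (Fin n → Fin n) → Fin c′ → Fin c
componentMap C C′ ρ = label C ∘ ρ ∘ representative C′

module _ {n} {I J : Inst n} {S S′ : Fin n → Set} {c c′}
         (C : NumComponents I S c) (C′ : NumComponents J S′ c′) (ρ : Fin n → Fin n)
         (ρ-∈ : ∀ {x} → S′ x → S (ρ x))
         (ρ-reflects : ∀ {x y} → S′ x → S′ y → Reach I S (ρ x) (ρ y) → Reach J S′ x y)
         where

  componentMap-injective : Injective _≡_ _≡_ (componentMap C C′ ρ)
  componentMap-injective {i} {j} e = begin
    i                              ≡⟨ label-representative C′ i ⟨
    label C′ (representative C′ i) ≡⟨ Reach⇒label-≡ C′ rᵢ∈S′ rⱼ∈S′ reach ⟩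
    label C′ (representative C′ j) ≡⟨ label-representative C′ j ⟩
    j                              ∎
    where
    open ≡-Reasoning
    rᵢ∈S′ : S′ (representative C′ i)
    rᵢ∈S′ = representative-∈ C′ i
    rⱼ∈S′ : S′ (representative C′ j)
    rⱼ∈S′ = representative-∈ C′ j
    reach : Reach J S′ (representative C′ i) (representative C′ j)
    reach = ρ-reflects rᵢ∈S′ rⱼ∈S′ (label-≡⇒Reach C (ρ-∈ rᵢ∈S′) (ρ-∈ rⱼ∈S′) e)

  components-≤ : c′ ℕ.≤ c
  components-≤ = Finₚ.injective⇒≤ componentMap-injective

module Rule1 {I : Inst n} (symmetric : SymmetricAdj I) where

  I′ : Inst n
  I′ = rule1 I

  kept⇒pres : T (pres I′ x) → T (pres I x)
  kept⇒pres {x} = ∧-fst (pres I x)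

  removed⇒deg≤1 : T (pres I x) → ¬ T (pres I′ x) → deg I x ℕ.≤ 1
  removed⇒deg≤1 x∈V x∉V′ = ℕₚ.≤ᵇ⇒≤ _ 1 (decidable-stable (T? _) λ deg≰1 →
    x∉V′ (∧-intro x∈V (not-intro deg≰1)))

  U′⇒U : InU I′ x → InU I x
  U′⇒U x∈U′ = ∧-intro (kept⇒pres (InU-pres I′ x∈U′)) (InU-inU I′ x∈U′)

  Edge′⇒Edge : Edge I′ x y → Edge I x y
  Edge′⇒Edge e = mkEdge I (kept⇒pres (Edge-pres₁ I′ e)) (kept⇒pres (Edge-pres₂ I′ e)) (Edge-adj I′ e)

  Edge⇒Edge′ : T (pres I′ x) → T (pres I′ y) → Edge I x y → Edge I′ x y
  Edge⇒Edge′ x∈V′ y∈V′ e = mkEdge I′ x∈V′ y∈V′ (Edge-adj I e)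

  -- Removed vertices have degree ≤ 1, so a walk in G[U] that enters one must step straight back out;
  -- it is enough to remember the kept vertex it came from.
  KeptPrefix : Fin n → Fin n → Set
  KeptPrefix x y = (T (pres I′ y) × Reach I′ (InU I′) x y)
                 ⊎ (¬ T (pres I′ y) × ∃ λ w → Reach I′ (InU I′) x w × Edge I y w)

  keptPrefix : InU I′ x → Reach I (InU I) x y → KeptPrefix x y
  keptPrefix x∈U′ (here _) = inj₁ (InU-pres I′ x∈U′ , here x∈U′)
  keptPrefix x∈U′ (step {z = z} r e z∈U) with keptPrefix x∈U′ r | T? (pres I′ z)
  ... | inj₁ (y∈V′ , r′) | yes z∈V′ =
    inj₁ (z∈V′ , step r′ (Edge⇒Edge′ y∈V′ z∈V′ e) (∧-intro z∈V′ (InU-inU I z∈U)))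
  ... | inj₁ (_ , r′)    | no z∉V′  = inj₂ (z∉V′ , _ , r′ , Edge-sym I symmetric e)
  ... | inj₂ (y∉V′ , w , r′ , yw) | _
    with deg≤1-unique I (removed⇒deg≤1 (Edge-pres₁ I e) y∉V′) e yw
  ...   | refl = inj₁ (InU-pres I′ (Reach-target r′) , r′)

  reach-kept : InU I′ x → InU I′ y → Reach I (InU I) x y → Reach I′ (InU I′) x y
  reach-kept x∈U′ y∈U′ r with keptPrefix x∈U′ r
  ... | inj₁ (_ , r′)    = r′
  ... | inj₂ (y∉V′ , _) = ⊥-elim (y∉V′ (InU-pres I′ y∈U′))

  lost-tent-nbr : Tent I x → ¬ Tent I′ x → ∃ λ u → Edge I x u × ¬ T (pres I′ u)
  lost-tent-nbr {x} τ ¬τ′ with Finₚ.any? (λ u → T? (edgeB I x u) ×-dec ¬? (T? (pres I′ u)))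
  ... | yes found = found
  ... | no none   = ⊥-elim (¬τ′ (Tent-transfer τ x∈D′ fwd Edge′⇒Edge id))
    where
    x∈V : T (pres I x)
    x∈V = InD-pres I (tent-∈D τ)

    x∈D′ : InD I′ x
    x∈D′ = ∧-intro (∧-intro x∈V (not-intro (3≰1 ∘ subst (ℕ._≤ 1) (tent-deg τ) ∘ ℕₚ.≤ᵇ⇒≤ _ 1)))
                   (∧-snd (pres I x) (tent-∈D τ))
      where
      3≰1 : ¬ 3 ℕ.≤ 1
      3≰1 (s≤s ())

    fwd : Edge I x w → Edge I′ x w
    fwd {w} e = Edge⇒Edge′ (InD-pres I′ x∈D′)
                  (decidable-stable (T? (pres I′ w)) λ w∉V′ → none (w , e , w∉V′)) e

  lost : Fin n → Bool
  lost x = isTent I x ∧ not (isTent I′ x)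

  lost⇒ : T (lost x) → Tent I x × ¬ Tent I′ x
  lost⇒ {x} t = Equivalence.to isTent⇔Tent (∧-fst (isTent I x) t)
              , not-elim (∧-snd (isTent I x) t) ∘ Equivalence.from isTent⇔Tent

  tents≤ : tents I ℕ.≤ tents I′ ℕ.+ count lost
  tents≤ = tents-≤-+-count {I = I} {J = I′} {p = lost} λ τ ¬τ′ →
    ∧-intro (Equivalence.from isTent⇔Tent τ) (not-intro (¬τ′ ∘ Equivalence.to isTent⇔Tent))

  module Orphan {x} (x-lost : T (lost x)) where

    τ : Tent I x
    τ = proj₁ (lost⇒ x-lost)

    removed-nbr : ∃ λ u → Edge I x u × ¬ T (pres I′ u)
    removed-nbr = lost-tent-nbr τ (proj₂ (lost⇒ x-lost))

    orphan : Fin n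
    orphan = proj₁ removed-nbr

    x–orphan : Edge I x orphan
    x–orphan = proj₁ (proj₂ removed-nbr)

    orphan-removed : ¬ T (pres I′ orphan)
    orphan-removed = proj₂ (proj₂ removed-nbr)

    orphan-∈U : InU I orphan
    orphan-∈U = ∧-intro (Edge-pres₂ I x–orphan) (tent-nbr∈U τ x–orphan)

    orphan-deg≤1 : deg I orphan ℕ.≤ 1
    orphan-deg≤1 = removed⇒deg≤1 (Edge-pres₂ I x–orphan) orphan-removed

    orphan–x : Edge I orphan x
    orphan–x = Edge-sym I symmetric x–orphan

    orphan-isolated : Edge I orphan z → ¬ InU I z
    orphan-isolated e z∈U with deg≤1-unique I orphan-deg≤1 orphan–x e
    ... | refl = InU≢InD I z∈U (tent-∈D τ) refl

  open Orphan

  orphan-unique : (px : T (lost x)) (py : T (lost y)) → orphan px ≡ orphan py → x ≡ y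
  orphan-unique px py o≡o =
    deg≤1-unique I (orphan-deg≤1 px) (orphan–x px) (subst (λ o → Edge I o _) (sym o≡o) (orphan–x py))

  ℓ′+lost≤ℓ : Ell I c → Ell I′ c′ → c′ ℕ.+ count lost ℕ.≤ c
  ℓ′+lost≤ℓ E E′ = +-count-≤ (componentMap E E′ id) (λ _ px → label E (orphan px))
    (componentMap-injective E E′ id U′⇒U reach-kept)
    (λ px py e → orphan-unique px py (Reach-isolated (orphan-isolated px)
                   (label-≡⇒Reach E (orphan-∈U px) (orphan-∈U py) e)))
    disjoint
    where
    disjoint : ∀ i x (px : T (lost x)) → componentMap E E′ id i ≢ label E (orphan px)
    disjoint i _ px e = orphan-removed px (subst (T ∘ pres I′) (sym o≡r) (InU-pres I′ r∈U′))
      where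
      r∈U′ : InU I′ (representative E′ i)
      r∈U′ = representative-∈ E′ i
      o≡r : orphan px ≡ representative E′ i
      o≡r = Reach-isolated (orphan-isolated px) (label-≡⇒Reach E (orphan-∈U px) (U′⇒U r∈U′) (sym e))

  ℓ′+t≤ℓ+t′ : Ell I c → Ell I′ c′ → c′ ℕ.+ tents I ℕ.≤ c ℕ.+ tents I′
  ℓ′+t≤ℓ+t′ {c} {c′} E E′ = begin
    c′ ℕ.+ tents I                       ≤⟨ ℕₚ.+-monoʳ-≤ c′ tents≤ ⟩
    c′ ℕ.+ (tents I′ ℕ.+ count lost)     ≡⟨ cong (c′ ℕ.+_) (ℕₚ.+-comm (tents I′) (count lost)) ⟩
    c′ ℕ.+ (count lost ℕ.+ tents I′)     ≡⟨ ℕₚ.+-assoc c′ (count lost) (tents I′) ⟨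
    (c′ ℕ.+ count lost) ℕ.+ tents I′     ≤⟨ ℕₚ.+-monoˡ-≤ (tents I′) (ℓ′+lost≤ℓ E E′) ⟩
    c ℕ.+ tents I′                       ∎
    where open ℕₚ.≤-Reasoning

module DVertexRemoval {I : Inst n} {v} (v∈D : InD I v) where

  present⁻ : Fin n → Bool
  present⁻ x = pres I x ∧ not (x == v)

  present⁻⇒pres : T (present⁻ x) → T (pres I x)
  present⁻⇒pres {x} = ∧-fst (pres I x)

  U⇒present⁻ : InU I x → T (present⁻ x)
  U⇒present⁻ x∈U = ∧-intro (InU-pres I x∈U) (fromWitnessFalse (InU≢InD I x∈U v∈D))

  U⇒U⁻ : InU I x → T (present⁻ x ∧ inU I x)
  U⇒U⁻ x∈U = ∧-intro (U⇒present⁻ x∈U) (InU-inU I x∈U)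

  U⁻⇒U : T (present⁻ x ∧ inU I x) → InU I x
  U⁻⇒U {x} x∈U⁻ = ∧-intro (present⁻⇒pres (∧-fst (present⁻ x) x∈U⁻)) (∧-snd (present⁻ x) x∈U⁻)

  tent-present⁻ : Tent I x → x ≢ v → T (present⁻ x)
  tent-present⁻ τ x≢v = ∧-intro (InD-pres I (tent-∈D τ)) (fromWitnessFalse x≢v)

  tent-D⁻ : Tent I x → x ≢ v → T (present⁻ x ∧ not (inU I x))
  tent-D⁻ {x} τ x≢v = ∧-intro (tent-present⁻ τ x≢v) (∧-snd (pres I x) (tent-∈D τ))

  tent-nbr-present⁻ : Tent I x → Edge I x w → T (present⁻ w)
  tent-nbr-present⁻ τ e =
    ∧-intro (Edge-pres₂ I e) (fromWitnessFalse λ { refl → Tent-¬Edge-D τ v∈D e })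

module DeleteV {I : Inst n} {v} (v∈D : InD I v) where
  open DVertexRemoval {I = I} v∈D

  I′ : Inst n
  I′ = deleteV I v

  reach-kept : InU I′ x → InU I′ y → Reach I (InU I) x y → Reach I′ (InU I′) x y
  reach-kept _ _ = Reach-map U⇒U⁻ λ x∈U y∈U e →
    mkEdge I′ (U⇒present⁻ x∈U) (U⇒present⁻ y∈U) (Edge-adj I e)

  tent-kept : Tent I x → x ≢ v → Tent I′ x
  tent-kept τ x≢v = Tent-transfer τ (tent-D⁻ τ x≢v)
    (λ e → mkEdge I′ (tent-present⁻ τ x≢v) (tent-nbr-present⁻ τ e) (Edge-adj I e))
    (λ e → mkEdge I (present⁻⇒pres (Edge-pres₁ I′ e)) (present⁻⇒pres (Edge-pres₂ I′ e)) (Edge-adj I′ e))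
    id

  lost-tent≡v : Tent I x → ¬ Tent I′ x → T (x == v)
  lost-tent≡v {x} τ ¬τ′ = decidable-stable (T? (x == v)) λ x≠v → ¬τ′ (tent-kept τ (x≠v ∘ fromWitness))

  ℓ′+t≤ℓ+t′+1 : Ell I c → Ell I′ c′ → c′ ℕ.+ tents I ℕ.≤ (c ℕ.+ tents I′) ℕ.+ 1
  ℓ′+t≤ℓ+t′+1 {c} {c′} E E′ = begin
    c′ ℕ.+ tents I                ≤⟨ ℕₚ.+-mono-≤ (components-≤ E E′ id U⁻⇒U reach-kept) tents≤ ⟩
    c ℕ.+ (tents I′ ℕ.+ 1)        ≡⟨ ℕₚ.+-assoc c (tents I′) 1 ⟨
    (c ℕ.+ tents I′) ℕ.+ 1        ∎
    where
    open ℕₚ.≤-Reasoning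
    tents≤ : tents I ℕ.≤ tents I′ ℕ.+ 1
    tents≤ = ℕₚ.≤-trans (tents-≤-+-count {p = _== v} lost-tent≡v)
                        (ℕₚ.+-monoʳ-≤ (tents I′) (count-≤1 {p = _== v} λ x≡v y≡v →
                           trans (toWitness x≡v) (sym (toWitness y≡v))))

module MoveToU {I : Inst n} {v u} (symmetric : SymmetricAdj I) (v∈D : InD I v) (deg-v≡2 : deg I v ≡ 2)
               (vu : Edge I v u) (u∈U : InU I u) where

  I′ : Inst n
  I′ = moveToU I v

  U⊆U′ : InU I x → InU I′ x
  U⊆U′ x∈U = ∧-intro (InU-pres I x∈U) (∨-introˡ (InU-inU I x∈U))

  v∈U′ : InU I′ v
  v∈U′ = ∧-intro (InD-pres I v∈D) (∨-introʳ (inU I v) (fromWitness refl))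

  ρ : Fin n → Fin n
  ρ x = if x == v then u else x

  ρ-cases : ∀ x → (x ≡ v × ρ x ≡ u) ⊎ (x ≢ v × ρ x ≡ x)
  ρ-cases x with x ≟ v
  ... | yes x≡v = inj₁ (x≡v , refl)
  ... | no  x≢v = inj₂ (x≢v , refl)

  ρ-∈ : InU I′ x → InU I (ρ x)
  ρ-∈ {x} x∈U′ with ρ-cases x
  ... | inj₁ (_ , ρx≡u) rewrite ρx≡u = u∈U
  ... | inj₂ (x≢v , ρx≡x) rewrite ρx≡x =
    ∧-intro (InU-pres I′ x∈U′) ([ id , ⊥-elim ∘ x≢v ∘ toWitness ] (∨-elim (inU I x) (InU-inU I′ x∈U′)))

  Reach-ρ : InU I′ x → Reach I′ (InU I′) x (ρ x)
  Reach-ρ {x} x∈U′ with ρ-cases x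
  ... | inj₁ (refl , ρv≡u) rewrite ρv≡u = step (here v∈U′) vu (U⊆U′ u∈U)
  ... | inj₂ (_ , ρx≡x)    rewrite ρx≡x = here x∈U′

  Reach-ρ⁻¹ : InU I′ x → Reach I′ (InU I′) (ρ x) x
  Reach-ρ⁻¹ {x} x∈U′ with ρ-cases x
  ... | inj₁ (refl , ρv≡u) rewrite ρv≡u = step (here (U⊆U′ u∈U)) (Edge-sym I symmetric vu) v∈U′
  ... | inj₂ (_ , ρx≡x)    rewrite ρx≡x = here x∈U′

  ρ-reflects : InU I′ x → InU I′ y → Reach I (InU I) (ρ x) (ρ y) → Reach I′ (InU I′) x y
  ρ-reflects x∈U′ y∈U′ r =
    Reach-trans (Reach-trans (Reach-ρ x∈U′) (Reach-map U⊆U′ (λ _ _ → id) r)) (Reach-ρ⁻¹ y∈U′)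

  tent-kept : Tent I x → Tent I′ x
  tent-kept {x} τ = Tent-transfer τ x∈D′ id id ∨-introˡ
    where
    x∈D : InD I x
    x∈D = tent-∈D τ
    x∈D′ : InD I′ x
    x∈D′ = ∧-intro (InD-pres I x∈D)
      (not-intro ([ InD-notU I x∈D , Tent-≢-deg2 τ deg-v≡2 ∘ toWitness ] ∘ ∨-elim (inU I x)))

  ℓ′+t≤ℓ+t′ : Ell I c → Ell I′ c′ → c′ ℕ.+ tents I ℕ.≤ c ℕ.+ tents I′
  ℓ′+t≤ℓ+t′ E E′ = ℕₚ.+-mono-≤ (components-≤ E E′ ρ ρ-∈ ρ-reflects) (tents-mono tent-kept)

module Contract {I : Inst n} {v a} (symmetric : SymmetricAdj I) (v∈D : InD I v) (deg-v≡2 : deg I v ≡ 2)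
                (va : Edge I v a) where
  open DVertexRemoval {I = I} v∈D

  I′ : Inst n
  I′ = contract I v a

  reach-kept : InU I′ x → InU I′ y → Reach I (InU I) x y → Reach I′ (InU I′) x y
  reach-kept _ _ = Reach-map U⇒U⁻ λ x∈U y∈U e →
    mkEdge I′ (U⇒present⁻ x∈U) (U⇒present⁻ y∈U) (∨-introˡ (Edge-adj I e))

  tent-kept : Tent I x → Tent I′ x
  tent-kept {x} τ = Tent-transfer τ (tent-D⁻ τ x≢v) fwd bwd id
    where
    x≢v : x ≢ v
    x≢v = Tent-≢-deg2 τ deg-v≡2

    ¬xv : ¬ T (adj I v x)
    ¬xv vx = Tent-¬Edge-D τ v∈D
      (Edge-sym I symmetric (mkEdge I (InD-pres I v∈D) (InD-pres I (tent-∈D τ)) vx))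

    x≢a : x ≢ a
    x≢a refl = Tent-¬Edge-D τ v∈D (Edge-sym I symmetric va)

    fwd : Edge I x w → Edge I′ x w
    fwd e = mkEdge I′ (tent-present⁻ τ x≢v) (tent-nbr-present⁻ τ e) (∨-introˡ (Edge-adj I e))

    bwd : Edge I′ x w → Edge I x w
    bwd {w} e = mkEdge I (present⁻⇒pres (Edge-pres₁ I′ e)) (present⁻⇒pres (Edge-pres₂ I′ e)) xw
      where
      xw : T (adj I x w)
      xw with ∨-elim (adj I x w) (Edge-adj I′ e)
      ... | inj₁ xw = xw
      ... | inj₂ new with ∨-elim ((x == a) ∧ adj I v w ∧ not (w == a)) new
      ...   | inj₁ x=a  = ⊥-elim (x≢a (toWitness (∧-fst (x == a) x=a)))
      ...   | inj₂ w=a  = ⊥-elim (¬xv (∧-fst (adj I v x) (∧-snd (w == a) w=a)))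

  ℓ′+t≤ℓ+t′ : Ell I c → Ell I′ c′ → c′ ℕ.+ tents I ℕ.≤ c ℕ.+ tents I′
  ℓ′+t≤ℓ+t′ E E′ = ℕₚ.+-mono-≤ (components-≤ E E′ id U⁻⇒U reach-kept) (tents-mono tent-kept)

i+j≤k+l⇒i-l≤k-j : ∀ {i j k l : ℤ} → i + j ≤ k + l → i - l ≤ k - j
i+j≤k+l⇒i-l≤k-j {i} {j} {k} {l} i+j≤k+l = begin
  i - l                 ≡⟨ shift i j l ⟩
  (i + j) - (j + l)     ≤⟨ ℤₚ.+-monoˡ-≤ (- (j + l)) i+j≤k+l ⟩
  (k + l) - (j + l)     ≡⟨ unshift k l j ⟩
  k - j                 ∎
  where
  open ℤₚ.≤-Reasoning
  shift : ∀ i j l → i - l ≡ (i + j) - (j + l)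
  shift = solve-∀
  unshift : ∀ k l j → (k + l) - (j + l) ≡ k - j
  unshift = solve-∀

mu-≤ : ∀ (I J : Inst n) c c′ → k J + + (c′ ℕ.+ tents I) ≤ k I + + (c ℕ.+ tents J) → mu J c′ ≤ mu I c
mu-≤ I J c c′ h = i+j≤k+l⇒i-l≤k-j {k J + + c′} {+ tents I} {k I + + c} {+ tents J}
  (subst₂ _≤_ (regroup (k J) c′ (tents I)) (regroup (k I) c (tents J)) h)
  where
  regroup : ∀ i m n → i + + (m ℕ.+ n) ≡ (i + + m) + + n
  regroup i m n = trans (cong (_+_ i) (ℤₚ.pos-+ m n)) (sym (ℤₚ.+-assoc i (+ m) (+ n)))

i-1+m≤i+n : ∀ (i : ℤ) {m n} → m ℕ.≤ n ℕ.+ 1 → (i - + 1) + + m ≤ i + + n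
i-1+m≤i+n i {m} {n} m≤n+1 = begin
  (i - + 1) + + m              ≤⟨ ℤₚ.+-monoʳ-≤ (i - + 1) (+≤+ m≤n+1) ⟩
  (i - + 1) + + (n ℕ.+ 1)      ≡⟨ cong (_+_ (i - + 1)) (ℤₚ.pos-+ n 1) ⟩
  (i - + 1) + (+ n + + 1)      ≡⟨ cancel i (+ n) ⟩
  i + + n                      ∎
  where
  open ℤₚ.≤-Reasoning
  cancel : ∀ i n → (i - + 1) + (n + + 1) ≡ i + n
  cancel = solve-∀

lemma1 : ∀ {n} (I I′ : Inst n) → Valid I → Step I I′
       → ∀ ℓ ℓ′ → Ell I ℓ → Ell I′ ℓ′ → mu I′ ℓ′ ≤ mu I ℓ
lemma1 I I′ (symmetric , _) (r1 _) ℓ ℓ′ E E′ =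
  mu-≤ I I′ ℓ ℓ′ (ℤₚ.+-monoʳ-≤ (k I) (+≤+ (Rule1.ℓ′+t≤ℓ+t′ symmetric E E′)))
lemma1 I I′ _ (r2 v _ (v∈D , _)) ℓ ℓ′ E E′ =
  mu-≤ I I′ ℓ ℓ′ (i-1+m≤i+n (k I) (DeleteV.ℓ′+t≤ℓ+t′+1 v∈D E E′))
lemma1 I I′ (symmetric , _) (r3U v u _ _ v∈D deg≡2 vu u∈U) ℓ ℓ′ E E′ =
  mu-≤ I I′ ℓ ℓ′ (ℤₚ.+-monoʳ-≤ (k I) (+≤+ (MoveToU.ℓ′+t≤ℓ+t′ symmetric v∈D deg≡2 vu u∈U E E′)))
lemma1 I I′ (symmetric , _) (r3D v a _ _ v∈D deg≡2 _ va) ℓ ℓ′ E E′ =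
  mu-≤ I I′ ℓ ℓ′ (ℤₚ.+-monoʳ-≤ (k I) (+≤+ (Contract.ℓ′+t≤ℓ+t′ symmetric v∈D deg≡2 va E E′)))
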